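{- Let $\mathbf L=(L,\vee,\wedge,{}^*,0,1)$ be a pseudocomplemented lattice satisfying the Stone identity $x^*\vee x^{**}=1$ for all $x\in L$, and let $A$ be a deductive system of the second kind of $\mathbf L$. Then: (i) if $a\in A$, $b\in L$ and $a\le b$ then $b\in A$; (ii) $A$ is a deductive system of the first kind of $\mathbf L$.
   Context: A bounded lattice is pseudocomplemented if for each $a$ there is a greatest element $a^*$ with $a\wedge a^*=0$ (no distributivity assumed). Define $x\rightarrow y:=x^*\vee y$ and $x\Rightarrow y:=x^*\vee y^{**}$. A deductive system of the first kind is a subset $A\subseteq L$ with $1\in A$ such that $x\in A$, $y\in L$, $x\rightarrow y\in A$ imply $y\in A$. A deductive system of the second kind is a subset $A\subseteq L$ with $1\in A$ such that $x\in A$, $y\in L$, $x\Rightarrow y\in A$ imply $y\in A$. -}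

module Defs where

open import Level using (Level; _⊔_; suc)
open import Relation.Unary using (Pred; _∈_)
open import Algebra.Lattice.Bundles using (Lattice)

record PseudocomplementedLattice (c ℓ : Level) : Set (suc (c ⊔ ℓ)) where
  field
    lattice : Lattice c ℓ
  open Lattice lattice public
  infix 4 _≤_
  _≤_ : Carrier → Carrier → Set ℓ
  x ≤ y = (x ∧ y) ≈ x
  infix 8 _*
  field
    𝟘 𝟙      : Carrier
    𝟘-least  : ∀ x → 𝟘 ≤ x
    𝟙-great  : ∀ x → x ≤ 𝟙
    _*       : Carrier → Carrier
    *-cong   : ∀ {x y} → x ≈ y → (x *) ≈ (y *)
    *-disj   : ∀ x → (x ∧ (x *)) ≈ 𝟘
    *-max    : ∀ x y → (x ∧ y) ≈ 𝟘 → y ≤ (x *)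

module _ {c ℓ : Level} (𝐋 : PseudocomplementedLattice c ℓ) where
  open PseudocomplementedLattice 𝐋

  Stone : Set (c ⊔ ℓ)
  Stone = ∀ x → ((x *) ∨ ((x *) *)) ≈ 𝟙

  _⟶_ : Carrier → Carrier → Carrier
  x ⟶ y = (x *) ∨ y

  _⟹_ : Carrier → Carrier → Carrier
  x ⟹ y = (x *) ∨ ((y *) *)

  DSFirst : ∀ {p} → Pred Carrier p → Set (c ⊔ p)
  DSFirst A = 𝟙 ∈ A × (∀ x y → x ∈ A → (x ⟶ y) ∈ A → y ∈ A)
    where open import Data.Product using (_×_)

  DSSecond : ∀ {p} → Pred Carrier p → Set (c ⊔ p)
  DSSecond A = 𝟙 ∈ A × (∀ x y → x ∈ A → (x ⟹ y) ∈ A → y ∈ A)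
    where open import Data.Product using (_×_)

-- In a Stone lattice a* ∨ a** = 1, so a ≤ b gives a ⟹ b = a* ∨ b** ≥ a* ∨ a** = 1; hence
-- modus ponens for ⟹ with the premise a ⟹ b = 1 ∈ A makes A upward closed. Since
-- x ⟶ y ≤ x ⟹ y (because y ≤ y**), upward closure turns modus ponens for ⟹ into
-- modus ponens for ⟶.
module Submission where

open import Defs
open import Level using (Level; _⊔_)
open import Data.Product using (_×_; _,_)
open import Relation.Unary using (Pred; _∈_)
open import Relation.Binary using (_Respects_)
import Algebra.Lattice.Properties.Lattice as LatticeProperties
import Relation.Binary.Lattice as Order
import Relation.Binary.Lattice.Properties.JoinSemilattice as JoinSemilatticeProperties
import Relation.Binary.Reasoning.Setoid as SetoidReasoning

module PseudocomplementedLatticeProperties {c ℓ : Level} (𝐋 : PseudocomplementedLattice c ℓ) where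
  open PseudocomplementedLattice 𝐋

  open LatticeProperties lattice using (∧-idem; ∨-∧-orderTheoreticLattice)

  -- The library's order-theoretic lattice orders by x ≈ x ∧ y, the symmetric form of _≤_.
  private
    module O = Order.Lattice ∨-∧-orderTheoreticLattice
    open JoinSemilatticeProperties O.joinSemilattice using (∨-monotonic)

  ≤-respˡ-≈ : ∀ {x y z} → x ≈ y → x ≤ z → y ≤ z
  ≤-respˡ-≈ x≈y x≤z = sym (O.≤-respˡ-≈ x≈y (sym x≤z))

  ∨-mono-≤ : ∀ {x y u v} → x ≤ y → u ≤ v → (x ∨ u) ≤ (y ∨ v)
  ∨-mono-≤ x≤y u≤v = sym (∨-monotonic (sym x≤y) (sym u≤v))

  ∨-monoʳ-≤ : ∀ x {u v} → u ≤ v → (x ∨ u) ≤ (x ∨ v)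
  ∨-monoʳ-≤ x = ∨-mono-≤ (∧-idem x)

  𝟙≤⇒≈𝟙 : ∀ {x} → 𝟙 ≤ x → x ≈ 𝟙
  𝟙≤⇒≈𝟙 {x} 𝟙≤x = O.antisym (sym (𝟙-great x)) (sym 𝟙≤x)

  *-antitone : ∀ {x y} → x ≤ y → (y *) ≤ (x *)
  *-antitone {x} {y} x≤y = *-max x (y *) (begin
    x ∧ (y *)       ≈⟨ ∧-congʳ (sym x≤y) ⟩
    (x ∧ y) ∧ (y *) ≈⟨ ∧-assoc x y (y *) ⟩
    x ∧ (y ∧ (y *)) ≈⟨ ∧-congˡ (*-disj y) ⟩
    x ∧ 𝟘           ≈⟨ ∧-comm x 𝟘 ⟩
    𝟘 ∧ x           ≈⟨ 𝟘-least x ⟩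
    𝟘               ∎)
    where open SetoidReasoning setoid

  **-monotone : ∀ {x y} → x ≤ y → ((x *) *) ≤ ((y *) *)
  **-monotone x≤y = *-antitone (*-antitone x≤y)

  x≤x** : ∀ x → x ≤ ((x *) *)
  x≤x** x = *-max (x *) x (trans (∧-comm (x *) x) (*-disj x))

  ⟶≤⟹ : ∀ x y → (_⟶_ 𝐋 x y) ≤ (_⟹_ 𝐋 x y)
  ⟶≤⟹ x y = ∨-monoʳ-≤ (x *) (x≤x** y)

  Stone⇒≤⇒⟹≈𝟙 : Stone 𝐋 → ∀ {a b} → a ≤ b → (_⟹_ 𝐋 a b) ≈ 𝟙
  Stone⇒≤⇒⟹≈𝟙 stone {a} a≤b =
    𝟙≤⇒≈𝟙 (≤-respˡ-≈ (stone a) (∨-monoʳ-≤ (a *) (**-monotone a≤b)))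

  UpwardClosed : ∀ {p} → Pred Carrier p → Set (c ⊔ ℓ ⊔ p)
  UpwardClosed A = ∀ a b → a ∈ A → a ≤ b → b ∈ A

  Stone⇒DSSecond⇒upwardClosed : Stone 𝐋 → ∀ {p} {A : Pred Carrier p} →
    A Respects _≈_ → DSSecond 𝐋 A → UpwardClosed A
  Stone⇒DSSecond⇒upwardClosed stone resp (𝟙∈A , mp) a b a∈A a≤b =
    mp a b a∈A (resp (sym (Stone⇒≤⇒⟹≈𝟙 stone a≤b)) 𝟙∈A)

  upwardClosed⇒DSSecond⇒DSFirst : ∀ {p} {A : Pred Carrier p} →
    UpwardClosed A → DSSecond 𝐋 A → DSFirst 𝐋 A
  upwardClosed⇒DSSecond⇒DSFirst up (𝟙∈A , mp) =
    𝟙∈A , λ x y x∈A x⟶y∈A → mp x y x∈A (up _ _ x⟶y∈A (⟶≤⟹ x y))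

lemma5p7 : ∀ {c ℓ p} (𝐋 : PseudocomplementedLattice c ℓ) → Stone 𝐋 →
    (A : Pred (PseudocomplementedLattice.Carrier 𝐋) p) →
    A Respects (PseudocomplementedLattice._≈_ 𝐋) →
    DSSecond 𝐋 A →
    (∀ a b → a ∈ A → PseudocomplementedLattice._≤_ 𝐋 a b → b ∈ A)
    × DSFirst 𝐋 A
lemma5p7 𝐋 stone A resp ds = up , upwardClosed⇒DSSecond⇒DSFirst up ds
  where
  open PseudocomplementedLatticeProperties 𝐋
  up : UpwardClosed A
  up = Stone⇒DSSecond⇒upwardClosed stone resp ds
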